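{- Let $m$ be a positive integer, let $\mathcal V$ be a nonempty $m$-variety and let $A\subseteq\{0,m,\to\}$. If $x\in\mathcal V(A)$, then $x\in\mathcal V(\{a\in A: a\le x\})$.
   Context: A numerical semigroup is a subset $\Lambda\subseteq\mathbb N_0$ containing $0$, closed under addition, with finite complement; its multiplicity is its smallest nonzero element and $\mathrm F(\Lambda)$ is the largest integer not in $\Lambda$. $\{0,m,\to\}=\{0\}\cup\{m,m+1,\dots\}$. A set $\mathcal V$ of numerical semigroups all of multiplicity $m$ is an $m$-variety if (V1) $\Lambda_1\cap\Lambda_2\in\mathcal V$ for all $\Lambda_1,\Lambda_2\in\mathcal V$ and (V2) $\Lambda\cup\{\mathrm F(\Lambda)\}\in\mathcal V$ for every $\Lambda\in\mathcal V$, $\Lambda\neq\{0,m,\to\}$ (for nonempty $\mathcal V$ this forces $\{0,m,\to\}\in\mathcal V$). For $B\subseteq\{0,m,\to\}$, $\mathcal V(B)$ is the intersection of all elements of $\mathcal V$ containing $B$. -}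

module Defs where

open import Data.Nat using (ℕ; _+_; _≤_; _<_; _≡ᵇ_; _≤ᵇ_)
open import Data.Bool using (Bool; true; false; _∧_; _∨_)
open import Data.Product using (Σ; ∃; _×_)
open import Relation.Binary.PropositionalEquality using (_≡_; _≗_)
open import Relation.Nullary using (¬_)

NSet : Set
NSet = ℕ → Bool

_∈ₛ_ : ℕ → NSet → Set
n ∈ₛ Λ = Λ n ≡ true

-- {0, m, →} = {0} ∪ {m, m+1, …}
full : ℕ → NSet
full m n = (n ≡ᵇ 0) ∨ (m ≤ᵇ n)

_∩ₛ_ : NSet → NSet → NSet
(Λ₁ ∩ₛ Λ₂) n = Λ₁ n ∧ Λ₂ n

insert : NSet → ℕ → NSet
insert Λ f n = Λ n ∨ (n ≡ᵇ f)

record IsNumericalSemigroup (Λ : NSet) : Set where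
  field
    zero∈    : 0 ∈ₛ Λ
    +-closed : ∀ a b → a ∈ₛ Λ → b ∈ₛ Λ → (a + b) ∈ₛ Λ
    cofinite : ∃ λ N → ∀ n → N ≤ n → n ∈ₛ Λ

record HasMultiplicity (m : ℕ) (Λ : NSet) : Set where
  field
    m-pos  : 0 < m
    m∈     : m ∈ₛ Λ
    m-least : ∀ n → 0 < n → n ∈ₛ Λ → m ≤ n

IsFrobenius : NSet → ℕ → Set
IsFrobenius Λ f = (¬ (f ∈ₛ Λ)) × (∀ n → f < n → n ∈ₛ Λ)

-- A set 𝒱 of numerical semigroups (a predicate on NSet, required to be
-- extensional, i.e. invariant under pointwise equality of characteristic
-- functions, since it is a set of sets) which is an m-variety.
record IsMVariety (m : ℕ) (𝒱 : NSet → Set) : Set where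
  field
    extensional : ∀ Λ Λ′ → Λ ≗ Λ′ → 𝒱 Λ → 𝒱 Λ′
    semigroup   : ∀ Λ → 𝒱 Λ → IsNumericalSemigroup Λ
    multiplicity : ∀ Λ → 𝒱 Λ → HasMultiplicity m Λ
    V1 : ∀ Λ₁ Λ₂ → 𝒱 Λ₁ → 𝒱 Λ₂ → 𝒱 (Λ₁ ∩ₛ Λ₂)
    V2 : ∀ Λ → 𝒱 Λ → ¬ (Λ ≗ full m) → ∀ f → IsFrobenius Λ f → 𝒱 (insert Λ f)

_∈𝒱⟨_⟩_ : ℕ → (NSet → Set) → (ℕ → Set) → Set
x ∈𝒱⟨ 𝒱 ⟩ B = ∀ Λ → 𝒱 Λ → (∀ b → B b → b ∈ₛ Λ) → x ∈ₛ Λ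

module Submission where

-- Let Λ ∈ 𝒱 contain every a ∈ A with a ≤ x; we show x ∈ Λ.  Call Λ
-- "complete above t" if it contains every n > t.  Since Λ is cofinite it is
-- complete above some N, and we argue by induction on the threshold t:
--
--  * if t ≤ x, then Λ contains all of A (the small elements by assumption,
--    the large ones by completeness), so x ∈ 𝒱(A) gives x ∈ Λ;
--  * if x < t and t ∈ Λ, then Λ is already complete above t - 1;
--  * if x < t and t ∉ Λ, then t is the Frobenius number of Λ.  When t < m,
--    every a ∈ A above x is at least m > t, so again Λ ⊇ A.  When m ≤ t,
--    Λ ≠ {0,m,→}, so by (V2) Λ ∪ {t} ∈ 𝒱; it is complete above t - 1, hence
--    contains x by induction, and x ≠ t gives x ∈ Λ.

open import Defs
open import Data.Nat using (ℕ; zero; suc; _≤_; _<_; _≤?_; _≡ᵇ_; z≤n; s≤s)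
open import Data.Nat.Properties
  using (≤ᵇ⇒≤; ≤⇒≤ᵇ; ≡ᵇ⇒≡; ≡⇒≡ᵇ; <-≤-trans; ≤-<-trans; <⇒≤; <⇒≢; ≰⇒>; m≤n⇒m<n∨m≡n)
open import Data.Bool using (true; false)
open import Data.Bool.Properties using (∨-zeroʳ; T-≡)
open import Data.Product using (∃; _×_; _,_)
open import Data.Sum using (inj₁; inj₂)
open import Data.Empty using (⊥-elim)
open import Function.Bundles using (Equivalence)
open import Relation.Nullary using (yes; no; ¬_)
open import Relation.Binary.PropositionalEquality using (_≡_; _≢_; refl; sym; trans; _≗_)

open Equivalence using (to; from)

_⊆ₛ_ : (ℕ → Set) → NSet → Set
B ⊆ₛ Λ = ∀ b → B b → b ∈ₛ Λ

CompleteAbove : ℕ → NSet → Set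
CompleteAbove t Λ = ∀ n → t < n → n ∈ₛ Λ

completeAbove-mono : ∀ {s t Λ} → s ≤ t → CompleteAbove s Λ → CompleteAbove t Λ
completeAbove-mono s≤t c n t<n = c n (≤-<-trans s≤t t<n)

completeAbove-pred : ∀ {t Λ} → suc t ∈ₛ Λ → CompleteAbove (suc t) Λ → CompleteAbove t Λ
completeAbove-pred t+1∈ c n t<n with m≤n⇒m<n∨m≡n t<n
... | inj₁ t+1<n = c n t+1<n
... | inj₂ refl = t+1∈

gap-isFrobenius : ∀ {t Λ} → ¬ (suc t ∈ₛ Λ) → CompleteAbove (suc t) Λ → IsFrobenius Λ (suc t)
gap-isFrobenius t+1∉ c = t+1∉ , c

full-positive : ∀ m a → a ∈ₛ full m → 0 < a → m ≤ a
full-positive m (suc a) a∈ _ = ≤ᵇ⇒≤ m (suc a) (from T-≡ a∈)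

full-≥ : ∀ m n → m ≤ n → n ∈ₛ full m
full-≥ m n m≤n rewrite to T-≡ (≤⇒≤ᵇ m≤n) = ∨-zeroʳ (n ≡ᵇ 0)

missing-≢full : ∀ m Λ f → m ≤ f → ¬ (f ∈ₛ Λ) → ¬ (Λ ≗ full m)
missing-≢full m Λ f m≤f f∉ Λ≗full = f∉ (trans (Λ≗full f) (full-≥ m f m≤f))

insert-⊇ : ∀ Λ f n → n ∈ₛ Λ → n ∈ₛ insert Λ f
insert-⊇ Λ f n n∈ rewrite n∈ = refl

insert-∋ : ∀ Λ f → f ∈ₛ insert Λ f
insert-∋ Λ f rewrite to T-≡ (≡⇒≡ᵇ f f refl) = ∨-zeroʳ (Λ f)

insert-≢ : ∀ Λ f n → n ∈ₛ insert Λ f → n ≢ f → n ∈ₛ Λ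
insert-≢ Λ f n n∈ n≢f with Λ n
... | true  = refl
... | false = ⊥-elim (n≢f (≡ᵇ⇒≡ n f (from T-≡ n∈)))

∉-of-false : ∀ {Λ n} → Λ n ≡ false → ¬ (n ∈ₛ Λ)
∉-of-false Λn≡false n∈ with trans (sym Λn≡false) n∈
... | ()

module Threshold {m : ℕ} {𝒱 : NSet → Set} (V : IsMVariety m 𝒱)
                 {A : ℕ → Set} (A⊆full : A ⊆ₛ full m)
                 {x : ℕ} (x∈𝒱A : x ∈𝒱⟨ 𝒱 ⟩ A) where
  open IsMVariety V

  A≤x : ℕ → Set
  A≤x a = A a × a ≤ x

  member-via-A : ∀ {Λ} → 𝒱 Λ → A≤x ⊆ₛ Λ → (∀ a → A a → x < a → a ∈ₛ Λ) → x ∈ₛ Λ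
  member-via-A {Λ} VΛ small large = x∈𝒱A Λ VΛ covers
    where
    covers : A ⊆ₛ Λ
    covers a Aa with a ≤? x
    ... | yes a≤x = small a (Aa , a≤x)
    ... | no  a≰x = large a Aa (≰⇒> a≰x)

  member-if-complete : ∀ {t Λ} → t ≤ x → 𝒱 Λ → A≤x ⊆ₛ Λ → CompleteAbove t Λ → x ∈ₛ Λ
  member-if-complete t≤x VΛ small c =
    member-via-A VΛ small (λ a _ x<a → completeAbove-mono t≤x c a x<a)

  member-below : ∀ t {Λ} → 𝒱 Λ → A≤x ⊆ₛ Λ → CompleteAbove t Λ → x ∈ₛ Λ
  member-below zero VΛ small c = member-if-complete z≤n VΛ small c
  member-below (suc t) {Λ} VΛ small c with x ≤? t
  ... | no x≰t = member-if-complete (≰⇒> x≰t) VΛ small c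
  ... | yes x≤t with Λ (suc t) in Λ[t+1]
  ...   | true  = member-below t VΛ small (completeAbove-pred Λ[t+1] c)
  ...   | false with m ≤? suc t
  ...     | no m≰t+1 = member-via-A VΛ small large
    where
    -- Elements of A above x are positive, hence ≥ m > t + 1.
    large : ∀ a → A a → x < a → a ∈ₛ Λ
    large a Aa x<a =
      c a (<-≤-trans (≰⇒> m≰t+1) (full-positive m a (A⊆full a Aa) (≤-<-trans z≤n x<a)))
  ...     | yes m≤t+1 = insert-≢ Λ (suc t) x x∈Λ′ (<⇒≢ (s≤s x≤t))
    where
    t+1∉ : ¬ (suc t ∈ₛ Λ)
    t+1∉ = ∉-of-false {Λ} Λ[t+1]

    Λ′ : NSet
    Λ′ = insert Λ (suc t)

    VΛ′ : 𝒱 Λ′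
    VΛ′ = V2 Λ VΛ (missing-≢full m Λ (suc t) m≤t+1 t+1∉) (suc t) (gap-isFrobenius t+1∉ c)

    complete′ : CompleteAbove t Λ′
    complete′ = completeAbove-pred (insert-∋ Λ (suc t)) (λ n t+1<n → insert-⊇ Λ (suc t) n (c n t+1<n))

    x∈Λ′ : x ∈ₛ Λ′
    x∈Λ′ = member-below t VΛ′ (λ a a∈ → insert-⊇ Λ (suc t) a (small a a∈)) complete′

mainTheorem12 : (m : ℕ) → 0 < m → (𝒱 : NSet → Set) → IsMVariety m 𝒱 → ∃ 𝒱
    → (A : ℕ → Set) → (∀ a → A a → a ∈ₛ full m)
    → ∀ x → x ∈𝒱⟨ 𝒱 ⟩ A → x ∈𝒱⟨ 𝒱 ⟩ (λ a → A a × a ≤ x)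
mainTheorem12 m _ 𝒱 V _ A A⊆full x x∈𝒱A Λ VΛ small
  with IsNumericalSemigroup.cofinite (IsMVariety.semigroup V Λ VΛ)
... | N , cofinite = Threshold.member-below V A⊆full x∈𝒱A N VΛ small complete
  where
  complete : CompleteAbove N Λ
  complete n N<n = cofinite n (<⇒≤ N<n)
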